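{- For all $n\ge 1$ and all integers $1\le t\le 2^n$, \[ \mathrm{La}(n,t)\le \Lambda^\star(n,t)\,\mathrm{La}(n). \]
   Context: For $\mathcal{F}\subseteq 2^{[n]}$, $G_\mathcal{F}$ is the graph on $\mathcal{F}$ with distinct $A,B$ adjacent iff $A\subseteq B$ or $B\subseteq A$. $\mathrm{La}(n)=\binom{n}{\lfloor n/2\rfloor}$, and $\mathrm{La}(n,t)$ is the largest size of $\mathcal{F}\subseteq 2^{[n]}$ such that every component of $G_\mathcal{F}$ has at most $t$ vertices. For $\sigma\in S_n$ (permutations of $[n]$) let $T(\sigma)=|\{F\in\mathcal{F}:\{\sigma(1),\dots,\sigma(|F|)\}=F\}|$, and $\Lambda(n,\mathcal{F})=\frac1{n!}\sum_{\sigma\in S_n}T(\sigma)$. $\Lambda^\star(n,t)$ is the maximum of $\Lambda(n,\mathcal{F})$ over all $\mathcal{F}\subseteq 2^{[n]}$ such that every component of $G_\mathcal{F}$ has at most $t$ vertices. -}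

module Defs where

open import Data.Nat using (ℕ; zero; suc; _+_; _*_; _!; _≤_; ⌊_/2⌋)
open import Data.Nat.Properties using (_!≢0)
open import Data.Nat.Combinatorics using (_C_)
open import Data.Bool using (Bool)
import Data.Bool as Bool
open import Data.Fin using (Fin)
import Data.Fin as Fin
open import Data.Fin.Subset using (Subset; _⊆_; ∣_∣; inside; ⊥)
open import Data.Vec using (Vec; []; _∷_; toList; _[_]≔_)
open import Data.Vec.Properties using (≡-dec)
open import Data.List using (List; []; _∷_; length; filter; map; concatMap; take; foldr)
open import Data.Nat.ListAction using (sum)
open import Data.List.Membership.Propositional using (_∈_)
open import Data.List.Relation.Unary.Unique.Propositional using (Unique)
open import Data.List.Relation.Unary.Unique.DecPropositional using (unique?)
open import Data.List.Relation.Unary.All using (All)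
open import Data.Product using (_×_; Σ; ∃)
open import Data.Sum using (_⊎_)
open import Data.Integer using (+_)
open import Data.Rational using (ℚ; _/_)
open import Relation.Binary.PropositionalEquality using (_≡_)

record Family (n : ℕ) : Set where
  constructor family
  field
    members : List (Subset n)
    distinct : Unique members
open Family public

size : ∀ {n} → Family n → ℕ
size 𝓕 = length (members 𝓕)

Adjacent : ∀ {n} → Subset n → Subset n → Set
Adjacent A B = (A ≡ B → Data.Empty.⊥) × (A ⊆ B ⊎ B ⊆ A)
  where import Data.Empty

data Reach {n} (𝓕 : Family n) (A : Subset n) : Subset n → Set where
  here : A ∈ members 𝓕 → Reach 𝓕 A A
  step : ∀ {B C} → Reach 𝓕 A B → C ∈ members 𝓕 → Adjacent B C → Reach 𝓕 A C

ComponentsAtMost : ∀ {n} → ℕ → Family n → Set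
ComponentsAtMost t 𝓕 =
  ∀ A → A ∈ members 𝓕 →
  ∀ (L : List _) → Unique L → All (Reach 𝓕 A) L → length L ≤ t

La : ℕ → ℕ
La n = n C ⌊ n /2⌋

IsLa : ℕ → ℕ → ℕ → Set
IsLa n t m =
  (Σ (Family n) λ 𝓕 → ComponentsAtMost t 𝓕 × size 𝓕 ≡ m) ×
  (∀ (𝓕 : Family n) → ComponentsAtMost t 𝓕 → size 𝓕 ≤ m)

-- Permutations σ ∈ S_n, as the list (σ(1),…,σ(n)) of their values.
-- All vectors of length k with entries in Fin n:
allVecs : (n k : ℕ) → List (Vec (Fin n) k)
allVecs n zero = [] ∷ []
allVecs n (suc k) = concatMap (λ i → map (i ∷_) (allVecs n k)) (Data.List.allFin n)
  where import Data.List

allPerms : (n : ℕ) → List (Vec (Fin n) n)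
allPerms n = filter (λ v → unique? Fin._≟_ (toList v)) (allVecs n n)

prefixSet : ∀ {n} → Vec (Fin n) n → ℕ → Subset n
prefixSet σ k = foldr (λ i s → s [ i ]≔ inside) ⊥ (take k (toList σ))

T : ∀ {n} → Family n → Vec (Fin n) n → ℕ
T 𝓕 σ = length (filter (λ F → ≡-dec Bool._≟_ (prefixSet σ ∣ F ∣) F) (members 𝓕))

Λ : (n : ℕ) → Family n → ℚ
Λ n 𝓕 = _/_ (+ sum (map (T 𝓕) (allPerms n))) (n !) {{n !≢0}}

IsΛ⋆ : ℕ → ℕ → ℚ → Set
IsΛ⋆ n t λ⋆ =
  (Σ (Family n) λ 𝓕 → ComponentsAtMost t 𝓕 × Λ n 𝓕 ≡ λ⋆) ×
  (∀ (𝓕 : Family n) → ComponentsAtMost t 𝓕 → Λ n 𝓕 Data.Rational.≤ λ⋆)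
  where import Data.Rational

module Submission where

-- Double counting.  Call a permutation σ compatible with F ∈ 𝓕 when its first ∣F∣ values
-- enumerate F.  Exactly ∣F∣! (n − ∣F∣)! permutations are compatible with F, and since the
-- central binomial coefficient La(n) is the largest one, ∣F∣! (n − ∣F∣)! · La(n) ≥ n!.
-- Each σ is compatible with exactly T(σ) members of 𝓕, so ∣𝓕∣ · n! ≤ La(n) · Σ_σ T(σ),
-- i.e. ∣𝓕∣ ≤ Λ(n,𝓕) · La(n).  An extremal family for La(n,t) is admissible for Λ⋆(n,t).

open import Defs
open import Data.Nat
  using (ℕ; zero; suc; _+_; _*_; _∸_; _⊓_; _!; _^_; _≤_; _<_; _≤′_; z≤n; s≤s; ≤′-refl; ≤′-step;
         ⌊_/2⌋; ⌈_/2⌉; NonZero; >-nonZero)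
open import Data.Nat.Properties
open import Data.Nat.Combinatorics
  using (nCk≡n!/k![n-k]!; k![n∸k]!∣n!; [n-k]*d[k+1]≡[k+1]*d[k])
open import Data.Nat.DivMod using (m/n*n≡m)
open import Data.Nat.ListAction using (sum)
open import Data.Nat.ListAction.Properties using (sum-++)
open import Data.Bool using (true; false; if_then_else_)
import Data.Bool as Bool
open import Data.Fin using (Fin)
import Data.Fin as Fin
open import Data.Fin.Subset using (Subset; _∈_; _∉_; ∣_∣; inside; outside; ⊥; ∁; _-_)
open import Data.Fin.Subset.Properties
  using (_∈?_; p─⊥≡p; p─q⊆p; drop-there; x∈p⇒x∉∁p; Empty-unique; ∣p∣≤n; ∣∁p∣≡n∸∣p∣)
open import Data.Vec using (Vec; []; _∷_; toList; _[_]≔_; here; there)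
open import Data.Vec.Properties using (≡-dec; length-toList)
open import Data.List
  using (List; []; _∷_; _++_; map; filter; concatMap; take; drop; foldr; length; allFin; tabulate)
open import Data.List.Properties
  using (map-++; map-cong; map-∘; map-tabulate; length-take; take++drop≡id)
open import Data.List.Relation.Unary.All as All using (All; []; _∷_)
open import Data.List.Relation.Unary.AllPairs using ([]; _∷_)
open import Data.List.Relation.Unary.Unique.Propositional using (Unique)
open import Data.List.Relation.Unary.Unique.DecPropositional using (unique?)
open import Data.List.Relation.Unary.Unique.Propositional.Properties using (++⁺)
open import Data.List.Relation.Binary.Disjoint.Propositional using (Disjoint)
open import Data.Product using (_×_; _,_; uncurry)
open import Data.Sum using (inj₁; inj₂)
import Data.Integer as ℤ
import Data.Integer.Properties as ℤ
open import Data.Rational using (ℚ; _/_; toℚᵘ)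
import Data.Rational as ℚ
import Data.Rational.Properties as ℚ
open import Data.Rational.Unnormalised
  using (*≤*) renaming (_/_ to _ᵘ/_; _*_ to _ᵘ*_)
import Data.Rational.Unnormalised as ℚᵘ
import Data.Rational.Unnormalised.Properties as ℚᵘ
open import Function using (id; _∘_; _⇔_; mk⇔; Equivalence)
open import Relation.Nullary using (Dec; yes; no; does; ¬_; contradiction)
open import Relation.Nullary.Decidable using (_×-dec_; map′)
open import Relation.Unary using (Pred; Decidable)
open import Relation.Binary.PropositionalEquality
open import Level using (0ℓ)
open import Algebra.Properties.CommutativeSemigroup +-commutativeSemigroup
  using () renaming (interchange to +-interchange)

private
  variable
    A B : Set
    n k : ℕ

∑ : (A → ℕ) → List A → ℕ
∑ f xs = sum (map f xs)

∑-cong : ∀ {f g : A → ℕ} → (∀ x → f x ≡ g x) → ∀ xs → ∑ f xs ≡ ∑ g xs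
∑-cong f≗g xs = cong sum (map-cong f≗g xs)

∑-mono-≤ : ∀ {f g : A → ℕ} → (∀ x → f x ≤ g x) → ∀ xs → ∑ f xs ≤ ∑ g xs
∑-mono-≤ f≤g []       = z≤n
∑-mono-≤ f≤g (x ∷ xs) = +-mono-≤ (f≤g x) (∑-mono-≤ f≤g xs)

∑-map : ∀ (f : B → ℕ) (g : A → B) xs → ∑ f (map g xs) ≡ ∑ (λ x → f (g x)) xs
∑-map f g xs = cong sum (sym (map-∘ xs))

∑-concatMap : ∀ (f : B → ℕ) (g : A → List B) xs →
              ∑ f (concatMap g xs) ≡ ∑ (λ x → ∑ f (g x)) xs
∑-concatMap f g []       = refl
∑-concatMap f g (x ∷ xs) = begin
  sum (map f (g x ++ concatMap g xs))         ≡⟨ cong sum (map-++ f (g x) _) ⟩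
  sum (map f (g x) ++ map f (concatMap g xs)) ≡⟨ sum-++ (map f (g x)) _ ⟩
  ∑ f (g x) + ∑ f (concatMap g xs)            ≡⟨ cong (∑ f (g x) +_) (∑-concatMap f g xs) ⟩
  ∑ f (g x) + ∑ (λ x → ∑ f (g x)) xs          ∎
  where open ≡-Reasoning

∑-const : ∀ c (xs : List A) → ∑ (λ _ → c) xs ≡ length xs * c
∑-const c []       = refl
∑-const c (x ∷ xs) = cong (c +_) (∑-const c xs)

∑-*ʳ : ∀ (f : A → ℕ) c xs → ∑ (λ x → f x * c) xs ≡ ∑ f xs * c
∑-*ʳ f c []       = refl
∑-*ʳ f c (x ∷ xs) =
  trans (cong (f x * c +_) (∑-*ʳ f c xs)) (sym (*-distribʳ-+ c (f x) (∑ f xs)))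

∑-+ : ∀ (f g : A → ℕ) xs → ∑ (λ x → f x + g x) xs ≡ ∑ f xs + ∑ g xs
∑-+ f g []       = refl
∑-+ f g (x ∷ xs) = trans (cong (f x + g x +_) (∑-+ f g xs)) (+-interchange (f x) (g x) _ _)

∑-swap : ∀ (f : A → B → ℕ) xs ys →
         ∑ (λ x → ∑ (f x) ys) xs ≡ ∑ (λ y → ∑ (λ x → f x y) xs) ys
∑-swap f []       ys = sym (trans (∑-const 0 ys) (*-zeroʳ (length ys)))
∑-swap f (x ∷ xs) ys = trans (cong (∑ (f x) ys +_) (∑-swap f xs ys)) (sym (∑-+ (f x) _ ys))

indicator : ∀ {P : Set} → Dec P → ℕ
indicator p? = if does p? then 1 else 0

indicator-mono : ∀ {P Q : Set} (p? : Dec P) (q? : Dec Q) → (P → Q) → indicator p? ≤ indicator q?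
indicator-mono (yes p) (yes q) P→Q = ≤-refl
indicator-mono (yes p) (no ¬q) P→Q = contradiction (P→Q p) ¬q
indicator-mono (no ¬p) q?      P→Q = z≤n

count : ∀ {P : Pred A 0ℓ} → Decidable P → List A → ℕ
count P? = ∑ (λ x → indicator (P? x))

count-mono-≤ : ∀ {P Q : Pred A 0ℓ} (P? : Decidable P) (Q? : Decidable Q) →
               (∀ {x} → P x → Q x) → ∀ xs → count P? xs ≤ count Q? xs
count-mono-≤ P? Q? P⊆Q = ∑-mono-≤ (λ x → indicator-mono (P? x) (Q? x) P⊆Q)

count-cong : ∀ {P Q : Pred A 0ℓ} (P? : Decidable P) (Q? : Decidable Q) →
             (∀ {x} → P x ⇔ Q x) → ∀ xs → count P? xs ≡ count Q? xs
count-cong P? Q? P⇔Q xs = ≤-antisym (count-mono-≤ P? Q? (Equivalence.to P⇔Q) xs)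
                                     (count-mono-≤ Q? P? (Equivalence.from P⇔Q) xs)

count-filter : ∀ {P Q : Pred A 0ℓ} (P? : Decidable P) (Q? : Decidable Q) xs →
               count Q? (filter P? xs) ≡ count (λ x → P? x ×-dec Q? x) xs
count-filter P? Q? []       = refl
count-filter P? Q? (x ∷ xs) with does (P? x)
... | true  = cong (indicator (Q? x) +_) (count-filter P? Q? xs)
... | false = count-filter P? Q? xs

count-none : ∀ {P : Pred A 0ℓ} (P? : Decidable P) → (∀ x → ¬ P x) → ∀ xs → count P? xs ≡ 0
count-none P? ¬P []       = refl
count-none P? ¬P (x ∷ xs) with P? x
... | yes p = contradiction p (¬P x)
... | no _  = count-none P? ¬P xs

length-filter≡count : ∀ {P : Pred A 0ℓ} (P? : Decidable P) xs →
                      length (filter P? xs) ≡ count P? xs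
length-filter≡count P? []       = refl
length-filter≡count P? (x ∷ xs) with does (P? x)
... | true  = cong suc (length-filter≡count P? xs)
... | false = length-filter≡count P? xs

x∈p⇒suc∣p-x∣≡∣p∣ : ∀ {p : Subset n} {x} → x ∈ p → suc ∣ p - x ∣ ≡ ∣ p ∣
x∈p⇒suc∣p-x∣≡∣p∣ {p = inside ∷ p}  here        = cong (suc ∘ ∣_∣) (p─⊥≡p p)
x∈p⇒suc∣p-x∣≡∣p∣ {p = inside ∷ p}  (there x∈p) = cong suc (x∈p⇒suc∣p-x∣≡∣p∣ x∈p)
x∈p⇒suc∣p-x∣≡∣p∣ {p = outside ∷ p} (there x∈p) = x∈p⇒suc∣p-x∣≡∣p∣ x∈p

x∈p⇒∣p-x∣≡k : ∀ {p : Subset n} {x} → x ∈ p → ∣ p ∣ ≡ suc k → ∣ p - x ∣ ≡ k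
x∈p⇒∣p-x∣≡k x∈p ∣p∣≡1+k = suc-injective (trans (x∈p⇒suc∣p-x∣≡∣p∣ x∈p) ∣p∣≡1+k)

x∉p-x : ∀ (p : Subset n) x → x ∉ p - x
x∉p-x (s ∷ p) Fin.zero    ()
x∉p-x (s ∷ p) (Fin.suc x) x∈p-x = x∉p-x p x (drop-there x∈p-x)

x∈p⇒[p-x][x]≔inside≡p : ∀ {p : Subset n} {x} → x ∈ p → (p - x) [ x ]≔ inside ≡ p
x∈p⇒[p-x][x]≔inside≡p {p = inside ∷ p} here        = cong (inside ∷_) (p─⊥≡p p)
x∈p⇒[p-x][x]≔inside≡p {p = s ∷ p}      (there x∈p) =
  cong (s ∷_) (x∈p⇒[p-x][x]≔inside≡p x∈p)

∣p∣≡0⇒p≡⊥ : ∀ {p : Subset n} → ∣ p ∣ ≡ 0 → p ≡ ⊥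
∣p∣≡0⇒p≡⊥ ∣p∣≡0 =
  Empty-unique (λ (x , x∈p) → 0≢1+n (trans (sym ∣p∣≡0) (sym (x∈p⇒suc∣p-x∣≡∣p∣ x∈p))))

∑-allFin≡∣S∣*c : ∀ (S : Subset n) {f : Fin n → ℕ} c →
                 (∀ {i} → i ∈ S → f i ≡ c) → (∀ {i} → i ∉ S → f i ≡ 0) →
                 ∑ f (allFin n) ≡ ∣ S ∣ * c
∑-allFin≡∣S∣*c S {f} c on off = trans (cong sum (map-tabulate id f)) (sum-tabulate S on off)
  where
  sum-tabulate : ∀ {m} (S : Subset m) {g : Fin m → ℕ} →
                 (∀ {i} → i ∈ S → g i ≡ c) → (∀ {i} → i ∉ S → g i ≡ 0) →
                 sum (tabulate g) ≡ ∣ S ∣ * c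
  sum-tabulate []            on off = refl
  sum-tabulate (inside ∷ S)  on off =
    cong₂ _+_ (on here) (sum-tabulate S (on ∘ there) (off ∘ (_∘ drop-there)))
  sum-tabulate (outside ∷ S) on off =
    cong₂ _+_ (off λ ()) (sum-tabulate S (on ∘ there) (off ∘ (_∘ drop-there)))

countVecs : ∀ n k {P : Pred (List (Fin n)) 0ℓ} → Decidable P → ℕ
countVecs n k P? = count (λ v → P? (toList v)) (allVecs n k)

countVecs-cong : ∀ {P Q : Pred (List (Fin n)) 0ℓ} (P? : Decidable P) (Q? : Decidable Q) →
                 (∀ {xs} → P xs ⇔ Q xs) → countVecs n k P? ≡ countVecs n k Q?
countVecs-cong {n} {k} P? Q? P⇔Q =
  count-cong (λ v → P? (toList v)) (λ v → Q? (toList v)) P⇔Q (allVecs n k)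

countVecs-choose : ∀ {P : Pred (List (Fin n)) 0ℓ} (P? : Decidable P) (S : Subset n) c →
                   (∀ {i} → i ∈ S → countVecs n k (λ xs → P? (i ∷ xs)) ≡ c) →
                   (∀ {i} → i ∉ S → ∀ xs → ¬ P (i ∷ xs)) →
                   countVecs n (suc k) P? ≡ ∣ S ∣ * c
countVecs-choose {n} {k} P? S c on off = begin
  countVecs n (suc k) P?
    ≡⟨ ∑-concatMap _ (λ i → map (i ∷_) (allVecs n k)) (allFin n) ⟩
  ∑ (λ i → count (λ v → P? (toList v)) (map (i ∷_) (allVecs n k))) (allFin n)
    ≡⟨ ∑-cong (λ i → ∑-map _ (i ∷_) (allVecs n k)) (allFin n) ⟩
  ∑ (λ i → countVecs n k (λ xs → P? (i ∷ xs))) (allFin n)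
    ≡⟨ ∑-allFin≡∣S∣*c S c on none ⟩
  ∣ S ∣ * c ∎
  where
  open ≡-Reasoning
  none : ∀ {i} → i ∉ S → countVecs n k (λ xs → P? (i ∷ xs)) ≡ 0
  none {i} i∉S = count-none (λ v → P? (i ∷ toList v)) (λ v → off i∉S (toList v)) (allVecs n k)

-- Recursive in S rather than Unique × All (_∈ S), so that counting by the first entry is
-- structural.
data DrawnFrom {n} : Subset n → List (Fin n) → Set where
  []  : ∀ {S} → DrawnFrom S []
  _∷_ : ∀ {S x xs} → x ∈ S → DrawnFrom (S - x) xs → DrawnFrom S (x ∷ xs)

drawnFrom? : ∀ (S : Subset n) → Decidable (DrawnFrom S)
drawnFrom? S []       = yes []
drawnFrom? S (x ∷ xs) =
  map′ (uncurry _∷_) (λ { (x∈S ∷ d) → x∈S , d }) (x ∈? S ×-dec drawnFrom? (S - x) xs)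

DrawnFrom-∷⇔ : ∀ {S : Subset n} {x xs} → x ∈ S → DrawnFrom S (x ∷ xs) ⇔ DrawnFrom (S - x) xs
DrawnFrom-∷⇔ x∈S = mk⇔ (λ { (_ ∷ d) → d }) (x∈S ∷_)

DrawnFrom-∉ : ∀ {S : Subset n} {x} → x ∉ S → ∀ xs → ¬ DrawnFrom S (x ∷ xs)
DrawnFrom-∉ x∉S xs (x∈S ∷ _) = x∉S x∈S

DrawnFrom⇒All∈ : ∀ {S : Subset n} {xs} → DrawnFrom S xs → All (_∈ S) xs
DrawnFrom⇒All∈ []        = []
DrawnFrom⇒All∈ (x∈S ∷ d) = x∈S ∷ All.map (p─q⊆p _ _) (DrawnFrom⇒All∈ d)

DrawnFrom⇒Unique : ∀ {S : Subset n} {xs} → DrawnFrom S xs → Unique xs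
DrawnFrom⇒Unique                   []      = []
DrawnFrom⇒Unique {S = S} {x ∷ xs} (_ ∷ d) =
  All.map (λ { y∈S-x refl → x∉p-x S x y∈S-x }) (DrawnFrom⇒All∈ d) ∷ DrawnFrom⇒Unique d

toSubset : List (Fin n) → Subset n
toSubset = foldr (λ i s → s [ i ]≔ inside) ⊥

DrawnFrom⇒toSubset≡ : ∀ {S : Subset n} {xs} → DrawnFrom S xs → length xs ≡ ∣ S ∣ → toSubset xs ≡ S
DrawnFrom⇒toSubset≡ []                              ∣S∣≡0    = sym (∣p∣≡0⇒p≡⊥ (sym ∣S∣≡0))
DrawnFrom⇒toSubset≡ {S = S} {x ∷ xs} (x∈S ∷ d) 1+ℓ≡∣S∣ = begin
  toSubset xs [ x ]≔ inside ≡⟨ cong (_[ x ]≔ inside) (DrawnFrom⇒toSubset≡ d ℓ≡∣S-x∣) ⟩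
  (S - x) [ x ]≔ inside     ≡⟨ x∈p⇒[p-x][x]≔inside≡p x∈S ⟩
  S                         ∎
  where
  open ≡-Reasoning
  ℓ≡∣S-x∣ : length xs ≡ ∣ S - x ∣
  ℓ≡∣S-x∣ = sym (x∈p⇒∣p-x∣≡k x∈S (sym 1+ℓ≡∣S∣))

countVecs-drawnFrom : ∀ k (S : Subset n) → ∣ S ∣ ≡ k → countVecs n k (drawnFrom? S) ≡ k !
countVecs-drawnFrom         zero    S _        = refl
countVecs-drawnFrom {n = n} (suc k) S ∣S∣≡1+k =
  trans (countVecs-choose (drawnFrom? S) S (k !) chosen DrawnFrom-∉) (cong (_* k !) ∣S∣≡1+k)
  where
  chosen : ∀ {i} → i ∈ S → countVecs n k (λ xs → drawnFrom? S (i ∷ xs)) ≡ k !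
  chosen {i} i∈S = trans
    (countVecs-cong {k = k} (λ xs → drawnFrom? S (i ∷ xs)) (drawnFrom? (S - i)) (DrawnFrom-∷⇔ i∈S))
    (countVecs-drawnFrom k (S - i) (x∈p⇒∣p-x∣≡k i∈S ∣S∣≡1+k))

DrawnFromThen : Subset n → ℕ → Pred (List (Fin n)) 0ℓ → Pred (List (Fin n)) 0ℓ
DrawnFromThen S a Q xs = DrawnFrom S (take a xs) × Q (drop a xs)

drawnFromThen? : ∀ (S : Subset n) a {Q} → Decidable Q → Decidable (DrawnFromThen S a Q)
drawnFromThen? S a Q? xs = drawnFrom? S (take a xs) ×-dec Q? (drop a xs)

countVecs-drawnFromThen : ∀ a {b} (S : Subset n) {Q} (Q? : Decidable Q) → ∣ S ∣ ≡ a →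
                          countVecs n (a + b) (drawnFromThen? S a Q?) ≡ a ! * countVecs n b Q?
countVecs-drawnFromThen zero {b} S Q? _ = trans
  (countVecs-cong {k = b} (drawnFromThen? S 0 Q?) Q? (mk⇔ (λ (_ , q) → q) ([] ,_)))
  (sym (+-identityʳ _))
countVecs-drawnFromThen {n = n} (suc a) {b} S {Q} Q? ∣S∣≡1+a = begin
  countVecs n (suc a + b) (drawnFromThen? S (suc a) Q?)
    ≡⟨ countVecs-choose (drawnFromThen? S (suc a) Q?) S _ chosen skipped ⟩
  ∣ S ∣ * (a ! * countVecs n b Q?) ≡⟨ cong (_* (a ! * countVecs n b Q?)) ∣S∣≡1+a ⟩
  suc a * (a ! * countVecs n b Q?) ≡⟨ *-assoc (suc a) (a !) _ ⟨
  suc a ! * countVecs n b Q?       ∎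
  where
  open ≡-Reasoning
  chosen : ∀ {i} → i ∈ S → countVecs n (a + b) (λ xs → drawnFromThen? S (suc a) Q? (i ∷ xs))
                           ≡ a ! * countVecs n b Q?
  chosen {i} i∈S = trans
    (countVecs-cong {k = a + b} (λ xs → drawnFromThen? S (suc a) Q? (i ∷ xs))
                                (drawnFromThen? (S - i) a Q?)
                                (mk⇔ (λ { ((_ ∷ d) , q) → d , q }) (λ (d , q) → (i∈S ∷ d) , q)))
    (countVecs-drawnFromThen a {b} (S - i) Q? (x∈p⇒∣p-x∣≡k i∈S ∣S∣≡1+a))
  skipped : ∀ {i} → i ∉ S → ∀ xs → ¬ DrawnFromThen S (suc a) Q (i ∷ xs)
  skipped i∉S xs (d , _) = DrawnFrom-∉ i∉S _ d

ListsFirst : Subset n → Pred (List (Fin n)) 0ℓ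
ListsFirst F = DrawnFromThen F ∣ F ∣ (DrawnFrom (∁ F))

listsFirst? : ∀ (F : Subset n) → Decidable (ListsFirst F)
listsFirst? F = drawnFromThen? F ∣ F ∣ (drawnFrom? (∁ F))

countVecs-listsFirst : ∀ (F : Subset n) → countVecs n n (listsFirst? F) ≡ ∣ F ∣ ! * (n ∸ ∣ F ∣) !
countVecs-listsFirst {n} F = begin
  countVecs n n (listsFirst? F)
    ≡⟨ cong (λ k → countVecs n k (listsFirst? F)) (m+[n∸m]≡n (∣p∣≤n F)) ⟨
  countVecs n (∣ F ∣ + (n ∸ ∣ F ∣)) (listsFirst? F)
    ≡⟨ countVecs-drawnFromThen ∣ F ∣ F (drawnFrom? (∁ F)) refl ⟩
  ∣ F ∣ ! * countVecs n (n ∸ ∣ F ∣) (drawnFrom? (∁ F))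
    ≡⟨ cong (∣ F ∣ ! *_) (countVecs-drawnFrom (n ∸ ∣ F ∣) (∁ F) (∣∁p∣≡n∸∣p∣ F)) ⟩
  ∣ F ∣ ! * (n ∸ ∣ F ∣) ! ∎
  where open ≡-Reasoning

ListsFirst⇒Unique : ∀ {F : Subset n} {xs} → ListsFirst F xs → Unique xs
ListsFirst⇒Unique {F = F} {xs} (d , d′) =
  subst Unique (take++drop≡id ∣ F ∣ xs) (++⁺ (DrawnFrom⇒Unique d) (DrawnFrom⇒Unique d′) disjoint)
  where
  disjoint : Disjoint (take ∣ F ∣ xs) (drop ∣ F ∣ xs)
  disjoint (y∈take , y∈drop) =
    x∈p⇒x∉∁p (All.lookup (DrawnFrom⇒All∈ d) y∈take) (All.lookup (DrawnFrom⇒All∈ d′) y∈drop)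

IsPrefixOf : Subset n → Vec (Fin n) n → Set
IsPrefixOf F σ = prefixSet σ ∣ F ∣ ≡ F

isPrefixOf? : ∀ (F : Subset n) σ → Dec (IsPrefixOf F σ)
isPrefixOf? F σ = ≡-dec Bool._≟_ (prefixSet σ ∣ F ∣) F

ListsFirst⇒IsPrefixOf : ∀ {F : Subset n} σ → ListsFirst F (toList σ) → IsPrefixOf F σ
ListsFirst⇒IsPrefixOf {n} {F} σ (d , _) = DrawnFrom⇒toSubset≡ d (begin
  length (take ∣ F ∣ (toList σ)) ≡⟨ length-take ∣ F ∣ (toList σ) ⟩
  ∣ F ∣ ⊓ length (toList σ)      ≡⟨ cong (∣ F ∣ ⊓_) (length-toList σ) ⟩
  ∣ F ∣ ⊓ n                      ≡⟨ m≤n⇒m⊓n≡m (∣p∣≤n F) ⟩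
  ∣ F ∣                          ∎)
  where open ≡-Reasoning

countVecs-listsFirst≤count-isPrefixOf : ∀ (F : Subset n) →
  countVecs n n (listsFirst? F) ≤ count (isPrefixOf? F) (allPerms n)
countVecs-listsFirst≤count-isPrefixOf {n} F = begin
  countVecs n n (listsFirst? F)
    ≤⟨ count-mono-≤ (λ σ → listsFirst? F (toList σ)) (λ σ → unique?′ σ ×-dec isPrefixOf? F σ)
                    (λ {σ} l → ListsFirst⇒Unique l , ListsFirst⇒IsPrefixOf σ l) (allVecs n n) ⟩
  count (λ σ → unique?′ σ ×-dec isPrefixOf? F σ) (allVecs n n)
    ≡⟨ count-filter unique?′ (isPrefixOf? F) (allVecs n n) ⟨
  count (isPrefixOf? F) (allPerms n) ∎
  where
  open ≤-Reasoning
  unique?′ : (σ : Vec (Fin n) n) → Dec (Unique (toList σ))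
  unique?′ σ = unique? Fin._≟_ (toList σ)

∑k!*[n∸k]!≤∑T : ∀ (𝓕 : Family n) →
                ∑ (λ F → ∣ F ∣ ! * (n ∸ ∣ F ∣) !) (members 𝓕) ≤ ∑ (T 𝓕) (allPerms n)
∑k!*[n∸k]!≤∑T {n} 𝓕 = begin
  ∑ (λ F → ∣ F ∣ ! * (n ∸ ∣ F ∣) !) (members 𝓕)
    ≡⟨ ∑-cong countVecs-listsFirst (members 𝓕) ⟨
  ∑ (λ F → countVecs n n (listsFirst? F)) (members 𝓕)
    ≤⟨ ∑-mono-≤ countVecs-listsFirst≤count-isPrefixOf (members 𝓕) ⟩
  ∑ (λ F → count (isPrefixOf? F) (allPerms n)) (members 𝓕)
    ≡⟨ ∑-swap (λ F σ → indicator (isPrefixOf? F σ)) (members 𝓕) (allPerms n) ⟩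
  ∑ (λ σ → count (λ F → isPrefixOf? F σ) (members 𝓕)) (allPerms n)
    ≡⟨ ∑-cong (λ σ → length-filter≡count (λ F → isPrefixOf? F σ) (members 𝓕)) (allPerms n) ⟨
  ∑ (T 𝓕) (allPerms n) ∎
  where open ≤-Reasoning

⌈n/2⌉≤1+⌊n/2⌋ : ∀ n → ⌈ n /2⌉ ≤ suc ⌊ n /2⌋
⌈n/2⌉≤1+⌊n/2⌋ zero          = z≤n
⌈n/2⌉≤1+⌊n/2⌋ (suc zero)    = s≤s z≤n
⌈n/2⌉≤1+⌊n/2⌋ (suc (suc n)) = s≤s (⌈n/2⌉≤1+⌊n/2⌋ n)

valley-min : ∀ (f : ℕ → ℕ) {h n} →
             (∀ {k} → suc k ≤ h → f (suc k) ≤ f k) →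
             (∀ {k} → h ≤ k → k < n → f k ≤ f (suc k)) →
             ∀ {k} → k ≤ n → f h ≤ f k
valley-min f {h} {n} down up {k} k≤n with ≤-total k h
... | inj₁ k≤h = descend ≤-refl (≤⇒≤′ k≤h)
  where
  descend : ∀ {m} → m ≤ h → k ≤′ m → f m ≤ f k
  descend m≤h ≤′-refl            = ≤-refl
  descend m≤h (≤′-step k≤′m-1) = ≤-trans (down m≤h) (descend (<⇒≤ m≤h) k≤′m-1)
... | inj₂ h≤k = ascend (≤⇒≤′ h≤k) k≤n
  where
  ascend : ∀ {m} → h ≤′ m → m ≤ n → f h ≤ f m
  ascend ≤′-refl            m≤n = ≤-refl
  ascend (≤′-step h≤′m-1) m≤n = ≤-trans (ascend h≤′m-1 (<⇒≤ m≤n)) (up (≤′⇒≤ h≤′m-1) m≤n)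

⌊n/2⌋-minimises-k!*[n∸k]! : ∀ n {k} → k ≤ n → ⌊ n /2⌋ ! * (n ∸ ⌊ n /2⌋) ! ≤ k ! * (n ∸ k) !
⌊n/2⌋-minimises-k!*[n∸k]! n = valley-min (λ k → k ! * (n ∸ k) !) down up
  where
  down : ∀ {k} → suc k ≤ ⌊ n /2⌋ → suc k ! * (n ∸ suc k) ! ≤ k ! * (n ∸ k) !
  down {k} 1+k≤h = *-cancelˡ-≤ (n ∸ k) {{>-nonZero (m<n⇒0<n∸m k<n)}} (begin
    (n ∸ k) * (suc k ! * (n ∸ suc k) !) ≡⟨ [n-k]*d[k+1]≡[k+1]*d[k] k<n ⟩
    suc k * (k ! * (n ∸ k) !)           ≤⟨ *-monoˡ-≤ _ 1+k≤n∸k ⟩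
    (n ∸ k) * (k ! * (n ∸ k) !)         ∎)
    where
    open ≤-Reasoning
    k<n : k < n
    k<n = ≤-trans 1+k≤h (⌊n/2⌋≤n n)
    k<⌈n/2⌉ : k < ⌈ n /2⌉
    k<⌈n/2⌉ = ≤-trans 1+k≤h (⌊n/2⌋≤⌈n/2⌉ n)
    1+k≤n∸k : suc k ≤ n ∸ k
    1+k≤n∸k = m+n≤o⇒m≤o∸n (suc k) (begin
      suc k + k           ≤⟨ +-mono-≤ 1+k≤h (≤-trans (n≤1+n k) k<⌈n/2⌉) ⟩
      ⌊ n /2⌋ + ⌈ n /2⌉   ≡⟨ ⌊n/2⌋+⌈n/2⌉≡n n ⟩
      n                   ∎)
  up : ∀ {k} → ⌊ n /2⌋ ≤ k → k < n → k ! * (n ∸ k) ! ≤ suc k ! * (n ∸ suc k) !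
  up {k} h≤k k<n = *-cancelˡ-≤ (suc k) (begin
    suc k * (k ! * (n ∸ k) !)           ≡⟨ [n-k]*d[k+1]≡[k+1]*d[k] k<n ⟨
    (n ∸ k) * (suc k ! * (n ∸ suc k) !) ≤⟨ *-monoˡ-≤ _ n∸k≤1+k ⟩
    suc k * (suc k ! * (n ∸ suc k) !)   ∎)
    where
    open ≤-Reasoning
    n∸k≤1+k : n ∸ k ≤ suc k
    n∸k≤1+k = m≤n+o⇒m∸n≤o n k (begin
      n                   ≡⟨ ⌊n/2⌋+⌈n/2⌉≡n n ⟨
      ⌊ n /2⌋ + ⌈ n /2⌉   ≤⟨ +-mono-≤ h≤k (≤-trans (⌈n/2⌉≤1+⌊n/2⌋ n) (s≤s h≤k)) ⟩
      k + suc k           ∎)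

La*⌊n/2⌋!*[n∸⌊n/2⌋]!≡n! : ∀ n → La n * (⌊ n /2⌋ ! * (n ∸ ⌊ n /2⌋) !) ≡ n !
La*⌊n/2⌋!*[n∸⌊n/2⌋]!≡n! n =
  trans (cong (_* (h ! * (n ∸ h) !)) (nCk≡n!/k![n-k]! h≤n))
        (m/n*n≡m {{h !* (n ∸ h) !≢0}} (k![n∸k]!∣n! h≤n))
  where
  h = ⌊ n /2⌋
  h≤n = ⌊n/2⌋≤n n

n!≤k!*[n∸k]!*La : ∀ n {k} → k ≤ n → n ! ≤ k ! * (n ∸ k) ! * La n
n!≤k!*[n∸k]!*La n {k} k≤n = begin
  n !                                      ≡⟨ La*⌊n/2⌋!*[n∸⌊n/2⌋]!≡n! n ⟨
  La n * (⌊ n /2⌋ ! * (n ∸ ⌊ n /2⌋) !)     ≤⟨ *-monoʳ-≤ (La n) (⌊n/2⌋-minimises-k!*[n∸k]! n k≤n) ⟩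
  La n * (k ! * (n ∸ k) !)                 ≡⟨ *-comm (La n) _ ⟩
  k ! * (n ∸ k) ! * La n                   ∎
  where open ≤-Reasoning

size*n!≤∑T*La : ∀ (𝓕 : Family n) → size 𝓕 * n ! ≤ ∑ (T 𝓕) (allPerms n) * La n
size*n!≤∑T*La {n} 𝓕 = begin
  size 𝓕 * n !                                         ≡⟨ ∑-const (n !) (members 𝓕) ⟨
  ∑ (λ _ → n !) (members 𝓕)                            ≤⟨ ∑-mono-≤ n!≤ (members 𝓕) ⟩
  ∑ (λ F → ∣ F ∣ ! * (n ∸ ∣ F ∣) ! * La n) (members 𝓕) ≡⟨ ∑-*ʳ _ (La n) (members 𝓕) ⟩
  ∑ (λ F → ∣ F ∣ ! * (n ∸ ∣ F ∣) !) (members 𝓕) * La n ≤⟨ *-monoˡ-≤ (La n) (∑k!*[n∸k]!≤∑T 𝓕) ⟩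
  ∑ (T 𝓕) (allPerms n) * La n                          ∎
  where
  open ≤-Reasoning
  n!≤ : ∀ F → n ! ≤ ∣ F ∣ ! * (n ∸ ∣ F ∣) ! * La n
  n!≤ F = n!≤k!*[n∸k]!*La n (∣p∣≤n F)

-- Proved through unnormalised rationals, where ≤ is plain cross-multiplication.
m/1≤S/d*L/1 : ∀ m S L d .{{_ : NonZero d}} → m * d ≤ S * L →
              ℤ.+ m / 1 ℚ.≤ (ℤ.+ S / d) ℚ.* (ℤ.+ L / 1)
m/1≤S/d*L/1 m S L d@(suc _) m*d≤S*L = ℚ.toℚᵘ-cancel-≤ in-ℚᵘ
  where
  cross-multiplied : ℤ.+ m ℤ.* ℤ.+ (d * 1) ℤ.≤ (ℤ.+ S ℤ.* ℤ.+ L) ℤ.* ℤ.+ 1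
  cross-multiplied = begin
    ℤ.+ m ℤ.* ℤ.+ (d * 1)       ≡⟨ cong (λ k → ℤ.+ m ℤ.* ℤ.+ k) (*-identityʳ d) ⟩
    ℤ.+ m ℤ.* ℤ.+ d             ≡⟨ ℤ.pos-* m d ⟨
    ℤ.+ (m * d)                 ≤⟨ ℤ.+≤+ m*d≤S*L ⟩
    ℤ.+ (S * L)                 ≡⟨ ℤ.pos-* S L ⟩
    ℤ.+ S ℤ.* ℤ.+ L             ≡⟨ ℤ.*-identityʳ _ ⟨
    (ℤ.+ S ℤ.* ℤ.+ L) ℤ.* ℤ.+ 1 ∎
    where open ℤ.≤-Reasoning
  in-ℚᵘ : toℚᵘ (ℤ.+ m / 1) ℚᵘ.≤ toℚᵘ ((ℤ.+ S / d) ℚ.* (ℤ.+ L / 1))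
  in-ℚᵘ = begin
    toℚᵘ (ℤ.+ m / 1)                     ≃⟨ ℚ.toℚᵘ-fromℚᵘ (ℤ.+ m ᵘ/ 1) ⟩
    ℤ.+ m ᵘ/ 1                           ≤⟨ *≤* cross-multiplied ⟩
    (ℤ.+ S ᵘ/ d) ᵘ* (ℤ.+ L ᵘ/ 1)         ≃⟨ ℚᵘ.*-cong (ℚ.toℚᵘ-fromℚᵘ (ℤ.+ S ᵘ/ d))
                                                        (ℚ.toℚᵘ-fromℚᵘ (ℤ.+ L ᵘ/ 1)) ⟨
    toℚᵘ (ℤ.+ S / d) ᵘ* toℚᵘ (ℤ.+ L / 1) ≃⟨ ℚ.toℚᵘ-homo-* (ℤ.+ S / d) (ℤ.+ L / 1) ⟨
    toℚᵘ ((ℤ.+ S / d) ℚ.* (ℤ.+ L / 1))   ∎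
    where open ℚᵘ.≤-Reasoning

lemma2p2 : ∀ (n t : ℕ) → 1 ≤ n → 1 ≤ t → t ≤ 2 ^ n →
    ∀ (m : ℕ) (λ⋆ : ℚ) → IsLa n t m → IsΛ⋆ n t λ⋆ →
    (ℤ.+ m / 1) ℚ.≤ λ⋆ ℚ.* (ℤ.+ La n / 1)
lemma2p2 n t _ _ _ _ λ⋆ ((𝓕 , components≤t , refl) , _) (_ , Λ≤λ⋆) = ℚ.≤-trans
  (m/1≤S/d*L/1 (size 𝓕) (∑ (T 𝓕) (allPerms n)) (La n) (n !) {{n !≢0}} (size*n!≤∑T*La 𝓕))
  (ℚ.*-monoʳ-≤-nonNeg (ℤ.+ La n / 1) {{ℚ.normalize-nonNeg (La n) 1}} (Λ≤λ⋆ 𝓕 components≤t))
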